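{- Let $m,n\ge1$. For $(u'',\ell')\in B_{m-1,n-1}\times B_{m-1,n}$ define $$\pi_{(u'',\ell')}=\Big\{\big(\text{the word of the } m+n-2 \text{ steps of }(Nu'')^{\mathbb{Z}}\text{ following the vertex }(y_1,y_2+1),\ \text{the word of the } m+n-1\text{ steps of }(E\ell')^{\mathbb{Z}}\text{ following the vertex }(y_1+1,y_2)\big)\Big\},$$ where $y=(y_1,y_2)$ runs over all stable intersections of $((Nu'')^{\mathbb{Z}},(E\ell')^{\mathbb{Z}})$. Then: the sets $\pi_{(u'',\ell')}$ form a partition $\Pi_{m,n}$ of $B_{m-1,n-1}\times B_{m-1,n}$ (any two are equal or disjoint, and they cover the set); every part of $\Pi_{m,n}$ has exactly $m$ elements; and every part contains exactly one pair $(u'',\ell')$ such that the two lattice paths starting at $(0,0)$ with step sequences $Nu''E$ and $E\ell'$ intersect only at their endpoints (i.e. they bound a parallelogram polyomino with an $m\times n$ bounding box).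
   Context: $B_{p,q}$ denotes the set of words over $\{N,E\}$ with exactly $p$ letters $E$ and $q$ letters $N$. A word is read as a lattice path with $N=(0,1)$ and $E=(1,0)$. For $w\in B_{p,q}$, the bi-infinite path $w^{\mathbb{Z}}$ is the concatenation over all $i\in\mathbb{Z}$ of the paths starting at $(pi,qi)$ with step sequence $w$. Thus $(Nu'')^{\mathbb{Z}}$ has period vector $(m-1,n)$ and $(E\ell')^{\mathbb{Z}}$ has period vector $(m,n)$, and both pass through $(0,0)$. A stable intersection of $((Nu'')^{\mathbb{Z}},(E\ell')^{\mathbb{Z}})$ is a lattice point $y$ lying on both paths such that the step of $(Nu'')^{\mathbb{Z}}$ starting at $y$ is $N$ and the step of $(E\ell')^{\mathbb{Z}}$ starting at $y$ is $E$. -}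

module Defs where

open import Data.Nat as ℕ using (ℕ; zero; suc; _≤_)
open import Data.Integer as ℤ using (ℤ; +_; _/ℕ_; _%ℕ_)
open import Data.Integer.DivMod using (n%ℕd<d)
open import Data.Fin using (fromℕ<)
open import Data.List using (List; []; _∷_; length; take; map; upTo; lookup; _++_; [_])
open import Data.Product using (_×_; _,_; ∃; ∃-syntax)
open import Relation.Binary.PropositionalEquality using (_≡_)

-- Letters of the alphabet {N, E}: N = (0,1), E = (1,0).
data Step : Set where
  N E : Step

Word : Set
Word = List Step

#E : Word → ℕ
#E []       = 0
#E (E ∷ w)  = suc (#E w)
#E (N ∷ w)  = #E w

#N : Word → ℕ
#N []       = 0
#N (N ∷ w)  = suc (#N w)
#N (E ∷ w)  = #N w

B : ℕ → ℕ → Word → Set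
B p q w = #E w ≡ p × #N w ≡ q

pos : Word → ℕ × ℕ
pos w = (#E w , #N w)

-- The bi-infinite path (d ∷ w)^ℤ of a nonempty word d ∷ w (period L =
-- length (d ∷ w), period vector (#E (d ∷ w), #N (d ∷ w))), indexed by
-- k ∈ ℤ.  Writing k = q·L + r with 0 ≤ r < L, its k-th vertex is
-- q·(period vector) + pos (take r (d ∷ w)), and its k-th step (the step
-- starting at the k-th vertex) is the r-th letter of d ∷ w.
-- The vertex with index 0 is (0,0).

vtx : Step → Word → ℤ → ℤ × ℤ
vtx d w k =
  ( (q ℤ.* + #E (d ∷ w)) ℤ.+ + #E (take r (d ∷ w))
  , (q ℤ.* + #N (d ∷ w)) ℤ.+ + #N (take r (d ∷ w)) )
  where
  q = k /ℕ suc (length w)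
  r = k %ℕ suc (length w)

stepAt : Step → Word → ℤ → Step
stepAt d w k = lookup (d ∷ w) (fromℕ< (n%ℕd<d k (suc (length w))))

window : Step → Word → ℤ → ℕ → Word
window d w k j = map (λ i → stepAt d w (k ℤ.+ + i)) (upTo j)

StableInt : Word → Word → ℤ × ℤ → Set
StableInt u'' ℓ' y =
  (∃[ k ] (vtx N u'' k ≡ y × stepAt N u'' k ≡ N)) ×
  (∃[ k ] (vtx E ℓ' k ≡ y × stepAt E ℓ' k ≡ E))

InPi : ℕ → ℕ → Word × Word → Word × Word → Set
InPi m n (u'' , ℓ') (a , b) =
  ∃[ y1 ] ∃[ y2 ] (StableInt u'' ℓ' (y1 , y2) ×
    (∃[ k ] (vtx N u'' k ≡ (y1 , y2 ℤ.+ + 1) ×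
             a ≡ window N u'' k ((m ℕ.∸ 1) ℕ.+ (n ℕ.∸ 1)))) ×
    (∃[ k ] (vtx E ℓ' k ≡ (y1 ℤ.+ + 1 , y2) ×
             b ≡ window E ℓ' k ((m ℕ.∸ 1) ℕ.+ n))))

Dom : ℕ → ℕ → Word × Word → Set
Dom m n (a , b) = B (m ℕ.∸ 1) (n ℕ.∸ 1) a × B (m ℕ.∸ 1) n b

OnPath : Word → ℕ × ℕ → Set
OnPath w p = ∃[ i ] (i ≤ length w × pos (take i w) ≡ p)

Parallelogram : ℕ → ℕ → Word × Word → Set
Parallelogram m n (u'' , ℓ') =
  ∀ p → OnPath (N ∷ (u'' ++ [ E ])) p → OnPath (E ∷ ℓ') p →
  (p ≡ (0 , 0)) Data.Sum.⊎ (p ≡ (m , n))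
  where import Data.Sum

-- Index the vertices of both bi-infinite paths by their antidiagonal and let D t be the horizontal
-- gap between the t-th vertices of (N u'')^ℤ and (E ℓ')^ℤ. Stable intersections are exactly the
-- descents of D from 0 to -1, and π_(u'',ℓ') is the set of pairs F t read off after them. Read
-- from a stable intersection t, the two paths are those of F t, so every element of a part
-- generates that same part. The periods satisfy L₂ = L₁ + 1, which makes D non-increasing along
-- each residue class modulo L₂ while drifting to +∞ and -∞ at its two ends; hence each residue
-- class of a position of an E in E ℓ' holds exactly one stable intersection, giving the m
-- elements of a part. The parallelogram pair comes from the last stable intersection, the one
-- after which D stays negative.

module Submission where

open import Defs

open import Data.Empty using (⊥; ⊥-elim)
open import Data.Fin using (fromℕ<)
open import Data.Integer as ℤ using (ℤ; +_; -[1+_]; _+_; _*_; _-_; -_; +≤+; +<+; -≤+; -<+; 0ℤ)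
import Data.Integer.Properties as ℤP
open import Data.Integer.DivMod using (n%ℕd<d; a≡a%ℕn+[a/ℕn]*n)
open import Data.Integer.Tactic.RingSolver using (solve-∀)
open import Data.List using (List; []; _∷_; length; take; drop; map; applyUpTo; lookup; _++_; [_])
import Data.List.Properties as ListP
open import Data.List.Membership.Propositional using (_∈_; find; lose)
open import Data.List.Membership.Propositional.Properties using (∈-map⁺; ∈-map⁻)
import Data.List.Relation.Unary.All as All
import Data.List.Relation.Unary.All.Properties as AllP
open import Data.List.Relation.Unary.Any using (here; there; any?)
open import Data.List.Relation.Unary.Unique.Propositional using (Unique; []; _∷_)
import Data.List.Relation.Unary.Unique.Propositional.Properties as UniqueP
open import Data.Nat as ℕ using (ℕ; zero; suc; z≤n; s≤s; _≤_)
import Data.Nat.Properties as ℕP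
open import Data.Product using (_×_; _,_; ∃; ∃-syntax; proj₁; proj₂)
import Data.Product.Properties as ProductP
open import Data.Sum using (_⊎_; inj₁; inj₂; [_,_]′)
open import Function.Bundles using (_⇔_; mk⇔; Equivalence)
open import Function.Construct.Composition using (_⇔-∘_)
open import Function.Construct.Symmetry using (⇔-sym)
open import Relation.Binary.Definitions using (DecidableEquality; tri<; tri≈; tri>)
open import Relation.Binary.PropositionalEquality hiding ([_])
open import Relation.Nullary using (Dec; yes; no)

open import Algebra.Properties.AbelianGroup ℤP.+-0-abelianGroup
  using () renaming (∙-cancelˡ to +-cancelˡ-≡; ∙-cancelʳ to +-cancelʳ-≡)

k+[1+i]≡k+1+i : ∀ k i → k + + suc i ≡ k + + 1 + + i
k+[1+i]≡k+1+i k i = trans (cong (λ e → k + e) (ℤP.pos-+ 1 i)) (sym (ℤP.+-assoc k (+ 1) (+ i)))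

k+[1+i]≡k+i+1 : ∀ k i → k + + suc i ≡ k + + i + + 1
k+[1+i]≡k+i+1 k i = trans (cong (λ e → k + e) (trans (cong +_ (ℕP.+-comm 1 i)) (ℤP.pos-+ i 1)))
                         (sym (ℤP.+-assoc k (+ i) (+ 1)))

<⇒≡+suc : ∀ {i j} → i ℤ.< j → ∃[ k ] j ≡ i + + suc k
<⇒≡+suc {i} {j} i<j = ℤ.∣ d ∣ , (begin
  j                       ≡⟨ solve j i ⟩
  i + (+ 1 + d)           ≡⟨ cong (λ e → i + (+ 1 + e)) (ℤP.0≤i⇒+∣i∣≡i 0≤d) ⟨
  i + + suc ℤ.∣ d ∣       ∎)
  where
  open ≡-Reasoning
  d = j - (+ 1 + i)
  0≤d : 0ℤ ℤ.≤ d
  0≤d = ℤP.i≤j⇒0≤j-i (ℤP.i<j⇒suc[i]≤j i<j)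
  solve : ∀ j i → j ≡ i + (+ 1 + (j - (+ 1 + i)))
  solve = solve-∀

module _ {L : ℕ} .{{_ : ℕ.NonZero L}} where

  private
    no-carry : ∀ {r r'} k → r ℕ.< L → + r ≢ + r' + + suc k * + L
    no-carry {r} {r'} k r<L eq = ℕP.<⇒≱ r<L (begin
      L                        ≤⟨ ℕP.m≤m+n L (k ℕ.* L) ⟩
      L ℕ.+ k ℕ.* L            ≤⟨ ℕP.m≤n+m _ r' ⟩
      r' ℕ.+ (L ℕ.+ k ℕ.* L)   ≡⟨ ℤP.+-injective (trans (ℤP.pos-+ r' (suc k ℕ.* L))
                                    (trans (cong (λ e → + r' + e) (ℤP.pos-* (suc k) L)) (sym eq))) ⟩
      r                        ∎)
      where open ℕP.≤-Reasoning

    carry : ∀ {r r' q q'} → q ℤ.< q' → + r + q * + L ≡ + r' + q' * + L →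
            ∃[ k ] + r ≡ + r' + + suc k * + L
    carry {r} {r'} {q} q<q' eq with <⇒≡+suc q<q'
    ... | k , refl = k , +-cancelʳ-≡ (q * + L) (+ r) _ (trans eq (solve (+ r') q (+ suc k) (+ L)))
      where
      solve : ∀ r q k L → r + (q + k) * L ≡ r + k * L + q * L
      solve = solve-∀

  quotient-unique : ∀ {r r'} q q' → r ℕ.< L → r' ℕ.< L →
                    + r + q * + L ≡ + r' + q' * + L → q ≡ q'
  quotient-unique q q' r<L r'<L eq with ℤP.<-cmp q q'
  ... | tri≈ _ q≡q' _ = q≡q'
  ... | tri< q<q' _ _ = let k , e = carry q<q' eq in ⊥-elim (no-carry k r<L e)
  ... | tri> _ _ q'<q = let k , e = carry q'<q (sym eq) in ⊥-elim (no-carry k r'<L e)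

  remainder-unique : ∀ {r r'} q q' → r ℕ.< L → r' ℕ.< L →
                     + r + q * + L ≡ + r' + q' * + L → r ≡ r'
  remainder-unique {r} {r'} q q' r<L r'<L eq with quotient-unique q q' r<L r'<L eq
  ... | refl = ℤP.+-injective (+-cancelʳ-≡ (q * + L) (+ r) (+ r') eq)

  [r+q*L]/ℕL≡q : ∀ r q → r ℕ.< L → (+ r + q * + L) ℤ./ℕ L ≡ q
  [r+q*L]/ℕL≡q r q r<L = sym (quotient-unique q (k ℤ./ℕ L) r<L (n%ℕd<d k L) (a≡a%ℕn+[a/ℕn]*n k L))
    where k = + r + q * + L

  [r+q*L]%ℕL≡r : ∀ r q → r ℕ.< L → (+ r + q * + L) ℤ.%ℕ L ≡ r
  [r+q*L]%ℕL≡r r q r<L = sym (remainder-unique q (k ℤ./ℕ L) r<L (n%ℕd<d k L) (a≡a%ℕn+[a/ℕn]*n k L))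
    where k = + r + q * + L

  divMod-elim : (P : ℤ → Set) → (∀ q r → r ℕ.< L → P (+ r + q * + L)) → ∀ k → P k
  divMod-elim P h k =
    subst P (sym (a≡a%ℕn+[a/ℕn]*n k L)) (h (k ℤ./ℕ L) (k ℤ.%ℕ L) (n%ℕd<d k L))

  later-in-class : ∀ t t' → t ℤ.%ℕ L ≡ t' ℤ.%ℕ L → t ℤ./ℕ L ℤ.< t' ℤ./ℕ L →
                   ∃[ k ] t' ≡ t + + suc k * + L
  later-in-class t t' r≡r' q<q' with <⇒≡+suc q<q'
  ... | k , q'≡ = k , (begin
    t'                                            ≡⟨ a≡a%ℕn+[a/ℕn]*n t' L ⟩
    + (t' ℤ.%ℕ L) + t' ℤ./ℕ L * + L               ≡⟨ cong₂ (λ r q → + r + q * + L) (sym r≡r') q'≡ ⟩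
    + (t ℤ.%ℕ L) + (t ℤ./ℕ L + + suc k) * + L     ≡⟨ solve (+ (t ℤ.%ℕ L)) (t ℤ./ℕ L) (+ suc k) (+ L) ⟩
    + (t ℤ.%ℕ L) + t ℤ./ℕ L * + L + + suc k * + L ≡⟨ cong (_+ + suc k * + L) (a≡a%ℕn+[a/ℕn]*n t L) ⟨
    t + + suc k * + L                             ∎)
    where
    open ≡-Reasoning
    solve : ∀ r q k L → r + (q + k) * L ≡ r + q * L + k * L
    solve = solve-∀

last-nonnegative : (h : ℕ → ℤ) (b : ℕ) → 0ℤ ℤ.≤ h 0 → h b ℤ.< 0ℤ →
  ∃[ s ] s ℕ.< b × 0ℤ ℤ.≤ h s × (∀ j → s ℕ.< j → j ℕ.≤ b → h j ℤ.< 0ℤ)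
last-nonnegative h zero    h0≥0 hb<0 = ⊥-elim (ℤP.<⇒≱ hb<0 h0≥0)
last-nonnegative h (suc b) h0≥0 h1+b<0 with 0ℤ ℤP.≤? h b
... | yes hb≥0 = b , ℕP.n<1+n b , hb≥0 ,
      λ j b<j j≤1+b → subst (λ i → h i ℤ.< 0ℤ) (ℕP.≤-antisym b<j j≤1+b) h1+b<0
... | no hb≱0 with last-nonnegative h b h0≥0 (ℤP.≰⇒> hb≱0)
...   | s , s<b , hs≥0 , after = s , ℕP.m<n⇒m<1+n s<b , hs≥0 , λ j s<j j≤1+b →
        [ (λ j<1+b → after j s<j (ℕP.≤-pred j<1+b)) , (λ { refl → h1+b<0 }) ]′ (ℕP.m≤n⇒m<n∨m≡n j≤1+b)

sign-change : (h : ℤ → ℤ) (a : ℤ) (n : ℕ) → 0ℤ ℤ.≤ h a → h (a + + n) ℤ.< 0ℤ →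
  ∃[ c ] 0ℤ ℤ.≤ h c × h (c + + 1) ℤ.< 0ℤ
sign-change h a zero    ha≥0 h<0 =
  ⊥-elim (ℤP.<⇒≱ (subst (λ k → h k ℤ.< 0ℤ) (ℤP.+-identityʳ a) h<0) ha≥0)
sign-change h a (suc n) ha≥0 h<0 with 0ℤ ℤP.≤? h (a + + n)
... | yes h≥0 = a + + n , h≥0 , subst (λ k → h k ℤ.< 0ℤ) (k+[1+i]≡k+i+1 a n) h<0
... | no  h≱0 = sign-change h a n ha≥0 (ℤP.≰⇒> h≱0)

-- the r-th letter of a word, with junk value N past its end
at : Word → ℕ → Step
at []       _       = N
at (x ∷ xs) zero    = x
at (x ∷ xs) (suc r) = at xs r

lookup≡at : ∀ W r (p : r ℕ.< length W) → lookup W (fromℕ< p) ≡ at W r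
lookup≡at (x ∷ W) zero    p = refl
lookup≡at (x ∷ W) (suc r) p = lookup≡at W r (ℕP.≤-pred p)

#E-++ : ∀ xs ys → #E (xs ++ ys) ≡ #E xs ℕ.+ #E ys
#E-++ []       ys = refl
#E-++ (E ∷ xs) ys = cong suc (#E-++ xs ys)
#E-++ (N ∷ xs) ys = #E-++ xs ys

#E+#N≡length : ∀ W → #E W ℕ.+ #N W ≡ length W
#E+#N≡length []      = refl
#E+#N≡length (E ∷ W) = cong suc (#E+#N≡length W)
#E+#N≡length (N ∷ W) = trans (ℕP.+-suc (#E W) (#N W)) (cong suc (#E+#N≡length W))

#E-take-suc : ∀ W r → r ℕ.< length W → #E (take (suc r) W) ≡ #E (take r W) ℕ.+ #E [ at W r ]
#E-take-suc (x ∷ W) zero    _ = trans (#E-++ [ x ] []) (ℕP.+-comm (#E [ x ]) 0)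
#E-take-suc (x ∷ W) (suc r) p = begin
  #E (x ∷ take (suc r) W)                           ≡⟨ #E-++ [ x ] (take (suc r) W) ⟩
  #E [ x ] ℕ.+ #E (take (suc r) W)                  ≡⟨ cong (#E [ x ] ℕ.+_) (#E-take-suc W r (ℕP.≤-pred p)) ⟩
  #E [ x ] ℕ.+ (#E (take r W) ℕ.+ #E [ at W r ])    ≡⟨ ℕP.+-assoc (#E [ x ]) _ _ ⟨
  #E [ x ] ℕ.+ #E (take r W) ℕ.+ #E [ at W r ]      ≡⟨ cong (ℕ._+ #E [ at W r ]) (#E-++ [ x ] (take r W)) ⟨
  #E (x ∷ take r W) ℕ.+ #E [ at W r ]               ∎
  where open ≡-Reasoning

drop≡at∷drop : ∀ W i → i ℕ.< length W → drop i W ≡ at W i ∷ drop (suc i) W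
drop≡at∷drop (x ∷ W) zero    _ = refl
drop≡at∷drop (x ∷ W) (suc i) p = drop≡at∷drop W i (ℕP.≤-pred p)

#N-determined : ∀ v w → length v ≡ length w → #E v ≡ #E w → #N v ≡ #N w
#N-determined v w |v|≡|w| #Ev≡#Ew = ℕP.+-cancelˡ-≡ (#E v) (#N v) (#N w) (begin
  #E v ℕ.+ #N v   ≡⟨ #E+#N≡length v ⟩
  length v        ≡⟨ |v|≡|w| ⟩
  length w        ≡⟨ #E+#N≡length w ⟨
  #E w ℕ.+ #N w   ≡⟨ cong (ℕ._+ #N w) #Ev≡#Ew ⟨
  #E v ℕ.+ #N w   ∎)
  where open ≡-Reasoning

B-intro : ∀ {p q} w → length w ≡ p ℕ.+ q → #E w ≡ p → B p q w
B-intro {p} {q} w |w|≡p+q #Ew≡p = #Ew≡p , ℕP.+-cancelˡ-≡ p (#N w) q (begin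
  p ℕ.+ #N w      ≡⟨ cong (ℕ._+ #N w) #Ew≡p ⟨
  #E w ℕ.+ #N w   ≡⟨ #E+#N≡length w ⟩
  length w        ≡⟨ |w|≡p+q ⟩
  p ℕ.+ q         ∎)
  where open ≡-Reasoning

take-++ˡ : ∀ i (xs ys : Word) → i ℕ.≤ length xs → take i (xs ++ ys) ≡ take i xs
take-++ˡ zero    xs       ys _   = refl
take-++ˡ (suc i) (x ∷ xs) ys i≤ = cong (x ∷_) (take-++ˡ i xs ys (ℕP.≤-pred i≤))

length-take≤ : ∀ r (W : Word) → r ℕ.≤ length W → length (take r W) ≡ r
length-take≤ r W r≤ = trans (ListP.length-take r W) (ℕP.m≤n⇒m⊓n≡m r≤)

pos-take-sum : ∀ i (w : Word) → i ℕ.≤ length w → proj₁ (pos (take i w)) ℕ.+ proj₂ (pos (take i w)) ≡ i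
pos-take-sum i w i≤ = trans (#E+#N≡length (take i w)) (length-take≤ i w i≤)

ePositions : Word → List ℕ
ePositions []      = []
ePositions (E ∷ w) = 0 ∷ map suc (ePositions w)
ePositions (N ∷ w) = map suc (ePositions w)

length-ePositions : ∀ w → length (ePositions w) ≡ #E w
length-ePositions []      = refl
length-ePositions (E ∷ w) = cong suc (trans (ListP.length-map suc (ePositions w)) (length-ePositions w))
length-ePositions (N ∷ w) = trans (ListP.length-map suc (ePositions w)) (length-ePositions w)

ePositions-unique : ∀ w → Unique (ePositions w)
ePositions-unique []      = []
ePositions-unique (E ∷ w) =
  AllP.map⁺ (All.universal (λ _ ()) (ePositions w)) ∷ UniqueP.map⁺ ℕP.suc-injective (ePositions-unique w)
ePositions-unique (N ∷ w) = UniqueP.map⁺ ℕP.suc-injective (ePositions-unique w)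

∈-ePositions⁻ : ∀ w {r} → r ∈ ePositions w → r ℕ.< length w × at w r ≡ E
∈-ePositions⁻ (E ∷ w) (here refl) = s≤s z≤n , refl
∈-ePositions⁻ (E ∷ w) (there r∈) with ∈-map⁻ suc r∈
... | r , r∈′ , refl = let r< , wr≡E = ∈-ePositions⁻ w r∈′ in s≤s r< , wr≡E
∈-ePositions⁻ (N ∷ w) r∈ with ∈-map⁻ suc r∈
... | r , r∈′ , refl = let r< , wr≡E = ∈-ePositions⁻ w r∈′ in s≤s r< , wr≡E

∈-ePositions⁺ : ∀ w {r} → r ℕ.< length w → at w r ≡ E → r ∈ ePositions w
∈-ePositions⁺ (E ∷ w) {zero}  _   _    = here refl
∈-ePositions⁺ (E ∷ w) {suc r} r<  wr≡E = there (∈-map⁺ suc (∈-ePositions⁺ w (ℕP.≤-pred r<) wr≡E))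
∈-ePositions⁺ (N ∷ w) {suc r} r<  wr≡E = ∈-map⁺ suc (∈-ePositions⁺ w (ℕP.≤-pred r<) wr≡E)

map-unique : ∀ {A B : Set} (f : A → B) {xs} → (∀ {x y} → x ∈ xs → y ∈ xs → f x ≡ f y → x ≡ y) →
             Unique xs → Unique (map f xs)
map-unique f          inj []           = []
map-unique f {x ∷ xs} inj (x∉xs ∷ uxs) =
  AllP.map⁺ (All.tabulate (λ {y} y∈xs fx≡fy → All.lookup x∉xs y∈xs (inj (here refl) (there y∈xs) fx≡fy))) ∷
  map-unique f (λ x∈ y∈ → inj (there x∈) (there y∈)) uxs

win : (ℤ → Step) → ℤ → ℕ → Word
win s k zero    = []
win s k (suc j) = s k ∷ win s (k + + 1) j

applyUpTo≡win : ∀ (g : ℕ → Step) s k j → (∀ i → g i ≡ s (k + + i)) → applyUpTo g j ≡ win s k j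
applyUpTo≡win g s k zero    g≗s = refl
applyUpTo≡win g s k (suc j) g≗s = cong₂ _∷_ (trans (g≗s 0) (cong s (ℤP.+-identityʳ k)))
  (applyUpTo≡win (λ i → g (suc i)) s (k + + 1) j (λ i → trans (g≗s (suc i)) (cong s (k+[1+i]≡k+1+i k i))))

window≡win : ∀ d w k j → window d w k j ≡ win (stepAt d w) k j
window≡win d w k j = trans (ListP.map-upTo _ j) (applyUpTo≡win _ (stepAt d w) k j (λ _ → refl))

length-win : ∀ s k j → length (win s k j) ≡ j
length-win s k zero    = refl
length-win s k (suc j) = cong suc (length-win s (k + + 1) j)

at-win : ∀ s k j i → i ℕ.< j → at (win s k j) i ≡ s (k + + i)
at-win s k (suc j) zero    _   = cong s (sym (ℤP.+-identityʳ k))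
at-win s k (suc j) (suc i) i<j =
  trans (at-win s (k + + 1) j i (ℕP.≤-pred i<j)) (cong s (sym (k+[1+i]≡k+1+i k i)))

win-cong : ∀ s s' k k' j → (∀ i → i ℕ.< j → s (k + + i) ≡ s' (k' + + i)) → win s k j ≡ win s' k' j
win-cong s s' k k' zero    _  = refl
win-cong s s' k k' (suc j) eq = cong₂ _∷_
  (trans (cong s (sym (ℤP.+-identityʳ k))) (trans (eq 0 (s≤s z≤n)) (cong s' (ℤP.+-identityʳ k'))))
  (win-cong s s' (k + + 1) (k' + + 1) j λ i i<j →
    trans (cong s (sym (k+[1+i]≡k+1+i k i))) (trans (eq (suc i) (s≤s i<j)) (cong s' (k+[1+i]≡k+1+i k' i))))

take-win : ∀ s k j i → i ℕ.≤ j → take i (win s k j) ≡ win s k i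
take-win s k j       zero    _   = refl
take-win s k (suc j) (suc i) i≤j = cong (s k ∷_) (take-win s (k + + 1) j i (ℕP.≤-pred i≤j))

-- x k is the abscissa of the k-th vertex of the path with steps s, whose ordinate is k - x k
record Traces (s : ℤ → Step) (x : ℤ → ℤ) : Set where
  constructor tracing
  field x-step : ∀ k → x (k + + 1) ≡ x k + + #E [ s k ]
open Traces public

module _ {s : ℤ → Step} {x : ℤ → ℤ} (tr : Traces s x) where

  traces-win : ∀ k j → x (k + + j) ≡ x k + + #E (win s k j)
  traces-win k zero    = trans (cong x (ℤP.+-identityʳ k)) (sym (ℤP.+-identityʳ (x k)))
  traces-win k (suc j) = begin
    x (k + + suc j)                                       ≡⟨ cong x (k+[1+i]≡k+1+i k j) ⟩
    x (k + + 1 + + j)                                     ≡⟨ traces-win (k + + 1) j ⟩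
    x (k + + 1) + + #E (win s (k + + 1) j)                ≡⟨ cong (_+ _) (x-step tr k) ⟩
    x k + + #E [ s k ] + + #E (win s (k + + 1) j)         ≡⟨ ℤP.+-assoc (x k) _ _ ⟩
    x k + (+ #E [ s k ] + + #E (win s (k + + 1) j))       ≡⟨ cong (λ e → x k + e) (ℤP.pos-+ (#E [ s k ]) _) ⟨
    x k + + (#E [ s k ] ℕ.+ #E (win s (k + + 1) j))       ≡⟨ cong (λ n → x k + + n) (#E-++ [ s k ] _) ⟨
    x k + + #E (win s k (suc j))                          ∎
    where open ≡-Reasoning

  traces-#E : ∀ k j p → x (k + + j) ≡ x k + + p → #E (win s k j) ≡ p
  traces-#E k j p x[k+j]≡ = ℤP.+-injective (+-cancelˡ-≡ (x k) _ _ (trans (sym (traces-win k j)) x[k+j]≡))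

  traces-shift : ∀ t → Traces (λ j → s (t + j)) (λ j → x (t + j) - x t)
  traces-shift t = tracing λ j → begin
    x (t + (j + + 1)) - x t                ≡⟨ cong (λ i → x i - x t) (ℤP.+-assoc t j (+ 1)) ⟨
    x (t + j + + 1) - x t                  ≡⟨ cong (_- x t) (x-step tr (t + j)) ⟩
    x (t + j) + + #E [ s (t + j) ] - x t   ≡⟨ solve (x (t + j)) (x t) _ ⟩
    x (t + j) - x t + + #E [ s (t + j) ]   ∎
    where
    open ≡-Reasoning
    solve : ∀ a b e → a + e - b ≡ a - b + e
    solve = solve-∀

traces-unique : ∀ {s s' x x'} → (∀ k → s k ≡ s' k) → Traces s x → Traces s' x' →
                x 0ℤ ≡ x' 0ℤ → ∀ k → x k ≡ x' k
traces-unique {s} {s'} {x} {x'} s≗s' tr tr' x0≡x'0 = go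
  where
  forward : ∀ k → x k ≡ x' k → x (k + + 1) ≡ x' (k + + 1)
  forward k eq = trans (x-step tr k) (trans (cong₂ (λ a b → a + + #E [ b ]) eq (s≗s' k)) (sym (x-step tr' k)))
  backward : ∀ k → x (k + + 1) ≡ x' (k + + 1) → x k ≡ x' k
  backward k eq = +-cancelʳ-≡ (+ #E [ s k ]) (x k) (x' k)
    (trans (sym (x-step tr k)) (trans eq (trans (x-step tr' k) (cong (λ b → x' k + + #E [ b ]) (sym (s≗s' k))))))
  go : ∀ k → x k ≡ x' k
  go (+ zero)     = x0≡x'0
  go (+ suc n)    = subst (λ k → x k ≡ x' k) (sym (k+[1+i]≡k+i+1 0ℤ n)) (forward (+ n) (go (+ n)))
  go -[1+ zero ]  = backward -[1+ 0 ] x0≡x'0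
  go -[1+ suc n ] = backward -[1+ suc n ] (go -[1+ n ])

periodic-ext : ∀ {A : Set} {L} .{{_ : ℕ.NonZero L}} {f g : ℤ → A} →
  (∀ k c → f (k + c * + L) ≡ f k) → (∀ k c → g (k + c * + L) ≡ g k) →
  (∀ r → r ℕ.< L → f (+ r) ≡ g (+ r)) → ∀ k → f k ≡ g k
periodic-ext {f = f} {g} f-per g-per eq = divMod-elim (λ k → f k ≡ g k)
  λ q r r<L → trans (f-per (+ r) q) (trans (eq r r<L) (sym (g-per (+ r) q)))

module Cyclic (d : Step) (w : Word) where

  W : Word
  W = d ∷ w

  L : ℕ
  L = suc (length w)

  s : ℤ → Step
  s = stepAt d w

  X Y : ℤ → ℤ
  X k = proj₁ (vtx d w k)
  Y k = proj₂ (vtx d w k)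

  s≡at : ∀ k → s k ≡ at W (k ℤ.%ℕ L)
  s≡at k = lookup≡at W (k ℤ.%ℕ L) (n%ℕd<d k L)

  s-canonical : ∀ q r → r ℕ.< L → s (+ r + q * + L) ≡ at W r
  s-canonical q r r<L = trans (s≡at (+ r + q * + L)) (cong (at W) ([r+q*L]%ℕL≡r r q r<L))

  s-nat : ∀ r → r ℕ.< L → s (+ r) ≡ at W r
  s-nat r r<L = trans (cong s (sym (ℤP.+-identityʳ (+ r)))) (s-canonical 0ℤ r r<L)

  X-canonical : ∀ q r → r ℕ.< L → X (+ r + q * + L) ≡ q * + #E W + + #E (take r W)
  X-canonical q r r<L = cong₂ (λ q r → q * + #E W + + #E (take r W))
    ([r+q*L]/ℕL≡q r q r<L) ([r+q*L]%ℕL≡r r q r<L)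

  Y-canonical : ∀ q r → r ℕ.< L → Y (+ r + q * + L) ≡ q * + #N W + + #N (take r W)
  Y-canonical q r r<L = cong₂ (λ q r → q * + #N W + + #N (take r W))
    ([r+q*L]/ℕL≡q r q r<L) ([r+q*L]%ℕL≡r r q r<L)

  X+Y : ∀ k → X k + Y k ≡ k
  X+Y = divMod-elim (λ k → X k + Y k ≡ k) λ q r r<L → begin
    X (+ r + q * + L) + Y (+ r + q * + L)
      ≡⟨ cong₂ _+_ (X-canonical q r r<L) (Y-canonical q r r<L) ⟩
    q * + #E W + + #E (take r W) + (q * + #N W + + #N (take r W))
      ≡⟨ solve q (+ #E W) (+ #N W) (+ #E (take r W)) (+ #N (take r W)) ⟩
    q * (+ #E W + + #N W) + (+ #E (take r W) + + #N (take r W))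
      ≡⟨ cong₂ (λ a b → q * a + b) (size W) (size (take r W)) ⟩
    q * + length W + + length (take r W)
      ≡⟨ cong (λ n → q * + L + + n) (length-take≤ r W (ℕP.<⇒≤ r<L)) ⟩
    q * + L + + r
      ≡⟨ ℤP.+-comm (q * + L) (+ r) ⟩
    + r + q * + L ∎
    where
    open ≡-Reasoning
    solve : ∀ q a b c e → q * a + c + (q * b + e) ≡ q * (a + b) + (c + e)
    solve = solve-∀
    size : ∀ V → + #E V + + #N V ≡ + length V
    size V = trans (sym (ℤP.pos-+ (#E V) (#N V))) (cong +_ (#E+#N≡length V))

  vtx≡ : ∀ k → vtx d w k ≡ (X k , k - X k)
  vtx≡ k = cong (X k ,_) (trans (solve (X k) (Y k)) (cong (_- X k) (X+Y k)))
    where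
    solve : ∀ x y → y ≡ x + y - x
    solve = solve-∀

  index : ∀ k {a b} → vtx d w k ≡ (a , b) → k ≡ a + b
  index k eq = trans (sym (X+Y k)) (cong₂ _+_ (cong proj₁ eq) (cong proj₂ eq))

  s-periodic : ∀ k c → s (k + c * + L) ≡ s k
  s-periodic = divMod-elim (λ k → ∀ c → s (k + c * + L) ≡ s k) λ q r r<L c → begin
    s (+ r + q * + L + c * + L)    ≡⟨ cong s (solve (+ r) q c (+ L)) ⟩
    s (+ r + (q + c) * + L)        ≡⟨ s-canonical (q + c) r r<L ⟩
    at W r                         ≡⟨ s-canonical q r r<L ⟨
    s (+ r + q * + L)              ∎
    where
    open ≡-Reasoning
    solve : ∀ a q c L → a + q * L + c * L ≡ a + (q + c) * L
    solve = solve-∀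

  X-periodic : ∀ k c → X (k + c * + L) ≡ X k + c * + #E W
  X-periodic = divMod-elim (λ k → ∀ c → X (k + c * + L) ≡ X k + c * + #E W) λ q r r<L c → begin
    X (+ r + q * + L + c * + L)                 ≡⟨ cong X (solve₁ (+ r) q c (+ L)) ⟩
    X (+ r + (q + c) * + L)                     ≡⟨ X-canonical (q + c) r r<L ⟩
    (q + c) * + #E W + + #E (take r W)          ≡⟨ solve₂ q c (+ #E W) (+ #E (take r W)) ⟩
    q * + #E W + + #E (take r W) + c * + #E W   ≡⟨ cong (_+ c * + #E W) (X-canonical q r r<L) ⟨
    X (+ r + q * + L) + c * + #E W              ∎
    where
    open ≡-Reasoning
    solve₁ : ∀ a q c L → a + q * L + c * L ≡ a + (q + c) * L
    solve₁ = solve-∀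
    solve₂ : ∀ q c e t → (q + c) * e + t ≡ q * e + t + c * e
    solve₂ = solve-∀

  traces : Traces s X
  traces = tracing (divMod-elim (λ k → X (k + + 1) ≡ X k + + #E [ s k ]) step)
    where
    open ≡-Reasoning
    prefix : ∀ q r → r ℕ.< L →
             q * + #E W + + #E (take (suc r) W) ≡ X (+ r + q * + L) + + #E [ s (+ r + q * + L) ]
    prefix q r r<L = begin
      q * + #E W + + #E (take (suc r) W)               ≡⟨ cong (λ n → q * + #E W + + n) (#E-take-suc W r r<L) ⟩
      q * + #E W + + (#E (take r W) ℕ.+ #E [ at W r ])  ≡⟨ cong (λ e → q * + #E W + e) (ℤP.pos-+ (#E (take r W)) _) ⟩
      q * + #E W + (+ #E (take r W) + + #E [ at W r ])  ≡⟨ ℤP.+-assoc (q * + #E W) _ _ ⟨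
      q * + #E W + + #E (take r W) + + #E [ at W r ]
        ≡⟨ cong₂ (λ a b → a + + #E [ b ]) (X-canonical q r r<L) (s-canonical q r r<L) ⟨
      X (+ r + q * + L) + + #E [ s (+ r + q * + L) ]   ∎
    step : ∀ q r → r ℕ.< L → X (+ r + q * + L + + 1) ≡ X (+ r + q * + L) + + #E [ s (+ r + q * + L) ]
    step q r r<L with ℕP.m≤n⇒m<n∨m≡n r<L
    ... | inj₁ 1+r<L = begin
      X (+ r + q * + L + + 1)                ≡⟨ cong X (solve (+ r) q (+ L)) ⟩
      X (+ suc r + q * + L)                  ≡⟨ X-canonical q (suc r) 1+r<L ⟩
      q * + #E W + + #E (take (suc r) W)     ≡⟨ prefix q r r<L ⟩
      X (+ r + q * + L) + + #E [ s (+ r + q * + L) ] ∎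
      where
      solve : ∀ r q L → r + q * L + + 1 ≡ + 1 + r + q * L
      solve = solve-∀
    ... | inj₂ refl = begin
      X (+ r + q * + L + + 1)                     ≡⟨ cong X (solve (+ r) q) ⟩
      X (+ 0 + (q + + 1) * + L)                   ≡⟨ X-canonical (q + + 1) 0 (s≤s z≤n) ⟩
      (q + + 1) * + #E W + + 0                    ≡⟨ solve′ q (+ #E W) ⟩
      q * + #E W + + #E W                         ≡⟨ cong (λ V → q * + #E W + + #E V) (ListP.take-all L W ℕP.≤-refl) ⟨
      q * + #E W + + #E (take L W)                ≡⟨ prefix q r r<L ⟩
      X (+ r + q * + L) + + #E [ s (+ r + q * + L) ] ∎
      where
      solve : ∀ r q → r + q * (+ 1 + r) + + 1 ≡ + 0 + (q + + 1) * (+ 1 + r)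
      solve = solve-∀
      solve′ : ∀ q e → (q + + 1) * e + + 0 ≡ q * e + e
      solve′ = solve-∀

  win-from : ∀ i j → i ℕ.+ j ≡ L → win s (+ i) j ≡ drop i W
  win-from i zero    i+0≡L = sym (ListP.drop-all i W (ℕP.≤-reflexive (trans (sym i+0≡L) (ℕP.+-identityʳ i))))
  win-from i (suc j) i+1+j≡L = begin
    s (+ i) ∷ win s (+ i + + 1) j   ≡⟨ cong₂ _∷_ (s-nat i i<L) (cong (λ k → win s k j) (sym (ℤP.pos-+ i 1))) ⟩
    at W i ∷ win s (+ (i ℕ.+ 1)) j  ≡⟨ cong (λ n → at W i ∷ win s (+ n) j) (ℕP.+-comm i 1) ⟩
    at W i ∷ win s (+ suc i) j      ≡⟨ cong (at W i ∷_) (win-from (suc i) j (trans (sym (ℕP.+-suc i j)) i+1+j≡L)) ⟩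
    at W i ∷ drop (suc i) W         ≡⟨ drop≡at∷drop W i i<L ⟨
    drop i W                        ∎
    where
    open ≡-Reasoning
    i<L : i ℕ.< L
    i<L = subst (i ℕ.<_) i+1+j≡L (ℕP.m<m+n i (s≤s z≤n))

  win-tail : win s (+ 1) (length w) ≡ w
  win-tail = win-from 1 (length w) refl

  X-period : ∀ k → X (k + + L) ≡ X k + + #E W
  X-period k = begin
    X (k + + L)              ≡⟨ cong (λ c → X (k + c)) (ℤP.*-identityˡ (+ L)) ⟨
    X (k + + 1 * + L)        ≡⟨ X-periodic k (+ 1) ⟩
    X k + + 1 * + #E W       ≡⟨ cong (λ e → X k + e) (ℤP.*-identityˡ (+ #E W)) ⟩
    X k + + #E W             ∎
    where open ≡-Reasoning

cyclic-shift : ∀ d w t {a} → a ≡ win (stepAt d w) (t + + 1) (length w) →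
               ∀ j → stepAt (stepAt d w t) a j ≡ stepAt d w (t + j)
cyclic-shift d w t refl = periodic-ext {L = C.L} shifted-periodic original-periodic agree
  where
  module C = Cyclic d w
  module C′ = Cyclic (C.s t) (win C.s (t + + 1) (length w))
  L′≡L : C′.L ≡ C.L
  L′≡L = cong suc (length-win C.s (t + + 1) (length w))
  shifted-periodic : ∀ k c → C′.s (k + c * + C.L) ≡ C′.s k
  shifted-periodic k c = subst (λ L → C′.s (k + c * + L) ≡ C′.s k) L′≡L (C′.s-periodic k c)
  original-periodic : ∀ k c → C.s (t + (k + c * + C.L)) ≡ C.s (t + k)
  original-periodic k c = trans (cong C.s (sym (ℤP.+-assoc t k _))) (C.s-periodic (t + k) c)
  agree : ∀ r → r ℕ.< C.L → C′.s (+ r) ≡ C.s (t + + r)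
  agree zero    _     = trans (C′.s-nat 0 (s≤s z≤n)) (cong C.s (sym (ℤP.+-identityʳ t)))
  agree (suc r) 1+r<L = begin
    C′.s (+ suc r)                             ≡⟨ C′.s-nat (suc r) (subst (suc r ℕ.<_) (sym L′≡L) 1+r<L) ⟩
    at (win C.s (t + + 1) (length w)) r        ≡⟨ at-win C.s (t + + 1) (length w) r (ℕP.≤-pred 1+r<L) ⟩
    C.s (t + + 1 + + r)                        ≡⟨ cong C.s (k+[1+i]≡k+1+i t r) ⟨
    C.s (t + + suc r)                          ∎
    where open ≡-Reasoning

-- Two paths compared along the antidiagonals

#E-diff≤1 : ∀ x y → + #E [ x ] - + #E [ y ] ℤ.≤ + 1
#E-diff≤1 N N = +≤+ z≤n
#E-diff≤1 N E = -≤+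
#E-diff≤1 E N = ℤP.≤-refl
#E-diff≤1 E E = +≤+ z≤n

-1≤#E-diff : ∀ x y → - + 1 ℤ.≤ + #E [ x ] - + #E [ y ]
-1≤#E-diff N N = -≤+
-1≤#E-diff N E = ℤP.≤-refl
-1≤#E-diff E N = -≤+
-1≤#E-diff E E = -≤+

crossing : ∀ d x y → 0ℤ ℤ.≤ d → d + (+ #E [ x ] - + #E [ y ]) ℤ.< 0ℤ → d ≡ 0ℤ × x ≡ N × y ≡ E
crossing (+ zero)  N E _         _         = refl , refl , refl
crossing (+ suc k) N E _         (+<+ ())
crossing (+ k)     N N _         (+<+ k<0) = ⊥-elim (ℕP.n≮0 k<0)
crossing (+ k)     E N _         (+<+ k<0) = ⊥-elim (ℕP.n≮0 k<0)
crossing (+ k)     E E _         (+<+ k<0) = ⊥-elim (ℕP.n≮0 k<0)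

-- vertices with the same index lie on the same antidiagonal, so D t ≡ 0ℤ means the paths meet there
module Pair {α β : ℤ → Step} {xα xβ : ℤ → ℤ} (trα : Traces α xα) (trβ : Traces β xβ) where

  D : ℤ → ℤ
  D t = xα t - xβ t

  record Stable (t : ℤ) : Set where
    constructor stable
    field
      D≡0 : D t ≡ 0ℤ
      α≡N : α t ≡ N
      β≡E : β t ≡ E

  D-win : ∀ t j → D (t + + j) ≡ D t + (+ #E (win α t j) - + #E (win β t j))
  D-win t j = trans (cong₂ _-_ (traces-win trα t j) (traces-win trβ t j))
    (solve (xα t) (xβ t) (+ #E (win α t j)) (+ #E (win β t j)))
    where
    solve : ∀ a b e f → a + e - (b + f) ≡ a - b + (e - f)
    solve = solve-∀

  D-step : ∀ t → D (t + + 1) ≡ D t + (+ #E [ α t ] - + #E [ β t ])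
  D-step t = trans (cong₂ _-_ (x-step trα t) (x-step trβ t)) (solve (xα t) (xβ t) _ _)
    where
    solve : ∀ a b e f → a + e - (b + f) ≡ a - b + (e - f)
    solve = solve-∀

  crossing⇒stable : ∀ t → 0ℤ ℤ.≤ D t → D (t + + 1) ℤ.< 0ℤ → Stable t
  crossing⇒stable t 0≤Dt D[t+1]<0 =
    let Dt≡0 , αt≡N , βt≡E = crossing (D t) (α t) (β t) 0≤Dt (subst (ℤ._< 0ℤ) (D-step t) D[t+1]<0)
    in stable Dt≡0 αt≡N βt≡E

  D-bounds : D 0ℤ ≡ 0ℤ → ∀ i → - + i ℤ.≤ D (+ i) × D (+ i) ℤ.≤ + i
  D-bounds D0≡0 zero    = subst (λ d → 0ℤ ℤ.≤ d × d ℤ.≤ 0ℤ) (sym D0≡0) (ℤP.≤-refl , ℤP.≤-refl)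
  D-bounds D0≡0 (suc i) =
    subst₂ ℤ._≤_ (sym (trans (cong -_ (k+[1+i]≡k+i+1 0ℤ i)) (ℤP.neg-distrib-+ (+ i) (+ 1)))) (sym step)
                 (ℤP.+-mono-≤ lower (-1≤#E-diff (α (+ i)) (β (+ i)))) ,
    subst₂ ℤ._≤_ (sym step) (sym (k+[1+i]≡k+i+1 0ℤ i)) (ℤP.+-mono-≤ upper (#E-diff≤1 (α (+ i)) (β (+ i))))
    where
    lower = proj₁ (D-bounds D0≡0 i)
    upper = proj₂ (D-bounds D0≡0 i)
    step : D (+ suc i) ≡ D (+ i) + (+ #E [ α (+ i) ] - + #E [ β (+ i) ])
    step = trans (cong D (k+[1+i]≡k+i+1 0ℤ i)) (D-step (+ i))

  -- D moves by at most one per step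
  negative-until-zero : ∀ t K → D (t + + 1) ℤ.< 0ℤ → (∀ i → 1 ℕ.≤ i → i ℕ.≤ K → D (t + + i) ≢ 0ℤ) →
                        ∀ i → 1 ℕ.≤ i → i ℕ.≤ K → D (t + + i) ℤ.< 0ℤ
  negative-until-zero t K D[t+1]<0 ≢0 (suc i) _ = go i
    where
    open ℤP.≤-Reasoning
    go : ∀ i → suc i ℕ.≤ K → D (t + + suc i) ℤ.< 0ℤ
    go zero    _     = D[t+1]<0
    go (suc i) 2+i≤K = ℤP.≤∧≢⇒< (begin
      D (t + + suc (suc i))                                    ≡⟨ cong D (k+[1+i]≡k+i+1 t (suc i)) ⟩
      D (t + + suc i + + 1)                                    ≡⟨ D-step (t + + suc i) ⟩
      D (t + + suc i) + (+ #E [ α (t + + suc i) ] - + #E [ β (t + + suc i) ])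
        ≤⟨ ℤP.+-monoʳ-≤ (D (t + + suc i)) (#E-diff≤1 (α (t + + suc i)) (β (t + + suc i))) ⟩
      D (t + + suc i) + + 1                                    ≡⟨ ℤP.+-comm (D (t + + suc i)) (+ 1) ⟩
      ℤ.suc (D (t + + suc i))                                  ≤⟨ ℤP.i<j⇒suc[i]≤j (go i (ℕP.<⇒≤ 2+i≤K)) ⟩
      0ℤ                                                       ∎) (≢0 (suc (suc i)) (s≤s z≤n) 2+i≤K)

-- The pair ((N u)^ℤ , (E l)^ℤ), with m = m' + 1 and n = n' + 1

module Setting (m' n' : ℕ) (u l : Word) (dom : Dom (suc m') (suc n') (u , l)) where

  module Upper = Cyclic N u
  module Lower = Cyclic E l
  open Pair Upper.traces Lower.traces public

  L₁ L₂ : ℕ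
  L₁ = Upper.L
  L₂ = Lower.L

  private
    #E-u : #E u ≡ m'
    #E-u = proj₁ (proj₁ dom)
    #E-l : #E l ≡ m'
    #E-l = proj₁ (proj₂ dom)

  length-u : length u ≡ m' ℕ.+ n'
  length-u = trans (sym (#E+#N≡length u)) (cong₂ ℕ._+_ #E-u (proj₂ (proj₁ dom)))

  length-l : length l ≡ m' ℕ.+ suc n'
  length-l = trans (sym (#E+#N≡length l)) (cong₂ ℕ._+_ #E-l (proj₂ (proj₂ dom)))

  L₂≡1+L₁ : L₂ ≡ suc L₁
  L₂≡1+L₁ = cong suc (trans length-l (trans (ℕP.+-suc m' n') (cong suc (sym length-u))))

  -- the element of π_(u,l) contributed by the stable intersection with index t
  F : ℤ → Word × Word
  F t = win Upper.s (t + + 1) (m' ℕ.+ n') , win Lower.s (t + + 1) (m' ℕ.+ suc n')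

  Upper-period : ∀ t → Upper.X (t + + L₁) ≡ Upper.X t + + m'
  Upper-period t = trans (Upper.X-period t) (cong (λ e → Upper.X t + + e) #E-u)

  Lower-period : ∀ t → Lower.X (t + + L₂) ≡ Lower.X t + + suc m'
  Lower-period t = trans (Lower.X-period t) (cong (λ e → Lower.X t + + suc e) #E-l)

  Upper-N : ∀ t → Upper.s t ≡ N → Upper.X (t + + 1) ≡ Upper.X t
  Upper-N t αt≡N = trans (x-step Upper.traces t)
    (trans (cong (λ x → Upper.X t + + #E [ x ]) αt≡N) (ℤP.+-identityʳ (Upper.X t)))

  Lower-E : ∀ t → Lower.s t ≡ E → Lower.X (t + + 1) ≡ Lower.X t + + 1
  Lower-E t βt≡E = trans (x-step Lower.traces t) (cong (λ x → Lower.X t + + #E [ x ]) βt≡E)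

  F-dom : ∀ {t} → Stable t → Dom (suc m') (suc n') (F t)
  F-dom {t} (stable _ αt≡N βt≡E) =
    B-intro (proj₁ (F t)) (length-win Upper.s (t + + 1) _) (traces-#E Upper.traces (t + + 1) (m' ℕ.+ n') m' (begin
      Upper.X (t + + 1 + + (m' ℕ.+ n'))     ≡⟨ cong Upper.X (k+[1+i]≡k+1+i t (m' ℕ.+ n')) ⟨
      Upper.X (t + + suc (m' ℕ.+ n'))       ≡⟨ cong (λ n → Upper.X (t + + suc n)) length-u ⟨
      Upper.X (t + + L₁)                    ≡⟨ Upper-period t ⟩
      Upper.X t + + m'                      ≡⟨ cong (_+ + m') (Upper-N t αt≡N) ⟨
      Upper.X (t + + 1) + + m'              ∎)) ,
    B-intro (proj₂ (F t)) (length-win Lower.s (t + + 1) _) (traces-#E Lower.traces (t + + 1) (m' ℕ.+ suc n') m' (begin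
      Lower.X (t + + 1 + + (m' ℕ.+ suc n'))   ≡⟨ cong Lower.X (k+[1+i]≡k+1+i t (m' ℕ.+ suc n')) ⟨
      Lower.X (t + + suc (m' ℕ.+ suc n'))     ≡⟨ cong (λ n → Lower.X (t + + suc n)) length-l ⟨
      Lower.X (t + + L₂)                      ≡⟨ Lower-period t ⟩
      Lower.X t + (+ 1 + + m')                ≡⟨ ℤP.+-assoc (Lower.X t) (+ 1) (+ m') ⟨
      Lower.X t + + 1 + + m'                  ≡⟨ cong (_+ + m') (Lower-E t βt≡E) ⟨
      Lower.X (t + + 1) + + m'                ∎))
    where open ≡-Reasoning

  stable-0 : Stable 0ℤ
  stable-0 = stable refl (Upper.s-nat 0 (s≤s z≤n)) (Lower.s-nat 0 (s≤s z≤n))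

  F-0 : F 0ℤ ≡ (u , l)
  F-0 = cong₂ _,_ (trans (cong (win Upper.s (+ 1)) (sym length-u)) Upper.win-tail)
                  (trans (cong (win Lower.s (+ 1)) (sym length-l)) Lower.win-tail)

  InPi⇒stable : ∀ {z} → InPi (suc m') (suc n') (u , l) z → ∃[ t ] Stable t × z ≡ F t
  InPi⇒stable {a , b} (y₁ , y₂ , ((t , vU , αt≡N) , (t' , vL , βt'≡E)) , (k , vU' , a≡) , (k' , vL' , b≡))
    with Upper.index t vU | Lower.index t' vL | Upper.index k vU' | Lower.index k' vL'
  ... | refl | refl | refl | refl =
    y₁ + y₂ , stable D≡0 αt≡N βt'≡E ,
    cong₂ _,_ (trans a≡ (trans (window≡win N u _ _) (cong (λ k → win Upper.s k _) (sym (ℤP.+-assoc y₁ y₂ (+ 1))))))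
              (trans b≡ (trans (window≡win E l _ _) (cong (λ k → win Lower.s k _) (solve y₁ y₂))))
    where
    D≡0 : D (y₁ + y₂) ≡ 0ℤ
    D≡0 = ℤP.i≡j⇒i-j≡0 (trans (cong proj₁ vU) (sym (cong proj₁ vL)))
    solve : ∀ a b → a + + 1 + b ≡ a + b + + 1
    solve = solve-∀

  stable⇒InPi : ∀ {t} → Stable t → InPi (suc m') (suc n') (u , l) (F t)
  stable⇒InPi {t} (stable Dt≡0 αt≡N βt≡E) =
    x , t - x ,
    ((t , Upper.vtx≡ t , αt≡N) , (t , trans (Lower.vtx≡ t) (cong (λ x → x , t - x) X-agree) , βt≡E)) ,
    (t + + 1 , upper-next , sym (window≡win N u (t + + 1) _)) ,
    (t + + 1 , lower-next , sym (window≡win E l (t + + 1) _))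
    where
    x = Upper.X t
    X-agree : Lower.X t ≡ x
    X-agree = sym (ℤP.i-j≡0⇒i≡j x (Lower.X t) Dt≡0)
    upper-next : vtx N u (t + + 1) ≡ (x , t - x + + 1)
    upper-next = trans (Upper.vtx≡ (t + + 1))
      (trans (cong (λ x′ → x′ , t + + 1 - x′) (Upper-N t αt≡N)) (cong (x ,_) (solve t x)))
      where
      solve : ∀ t x → t + + 1 - x ≡ t - x + + 1
      solve = solve-∀
    lower-next : vtx E l (t + + 1) ≡ (x + + 1 , t - x)
    lower-next = trans (Lower.vtx≡ (t + + 1))
      (trans (cong (λ x′ → x′ , t + + 1 - x′) (trans (Lower-E t βt≡E) (cong (_+ + 1) X-agree)))
             (cong (x + + 1 ,_) (solve t x)))
      where
      solve : ∀ t x → t + + 1 - (x + + 1) ≡ t - x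
      solve = solve-∀

  D-period : ∀ t → D (t + + L₂) ≡ D t + (+ #E [ Upper.s t ] - + 1)
  D-period t = begin
    Upper.X (t + + L₂) - Lower.X (t + + L₂)
      ≡⟨ cong₂ _-_ upper (Lower-period t) ⟩
    Upper.X t + + #E [ Upper.s t ] + + m' - (Lower.X t + (+ 1 + + m'))
      ≡⟨ solve (Upper.X t) (Lower.X t) (+ #E [ Upper.s t ]) (+ m') ⟩
    D t + (+ #E [ Upper.s t ] - + 1) ∎
    where
    open ≡-Reasoning
    solve : ∀ a b e m → a + e + m - (b + (+ 1 + m)) ≡ a - b + (e - + 1)
    solve = solve-∀
    upper : Upper.X (t + + L₂) ≡ Upper.X t + + #E [ Upper.s t ] + + m'
    upper = begin
      Upper.X (t + + L₂)          ≡⟨ cong (λ L → Upper.X (t + + L)) L₂≡1+L₁ ⟩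
      Upper.X (t + + suc L₁)      ≡⟨ cong Upper.X (k+[1+i]≡k+1+i t L₁) ⟩
      Upper.X (t + + 1 + + L₁)    ≡⟨ Upper-period (t + + 1) ⟩
      Upper.X (t + + 1) + + m'    ≡⟨ cong (_+ + m') (x-step Upper.traces t) ⟩
      Upper.X t + + #E [ Upper.s t ] + + m' ∎

  D-period-≤ : ∀ t → D (t + + L₂) ℤ.≤ D t
  D-period-≤ t = subst (ℤ._≤ D t) (sym (D-period t))
    (ℤP.≤-trans (ℤP.+-monoʳ-≤ (D t) (step-1≤0 (Upper.s t))) (ℤP.≤-reflexive (ℤP.+-identityʳ (D t))))
    where
    step-1≤0 : ∀ x → + #E [ x ] - + 1 ℤ.≤ 0ℤ
    step-1≤0 N = -≤+
    step-1≤0 E = ℤP.≤-refl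

  D-periods-≤ : ∀ t k → D (t + + k * + L₂) ℤ.≤ D t
  D-periods-≤ t zero    = ℤP.≤-reflexive (cong D (ℤP.+-identityʳ t))
  D-periods-≤ t (suc k) = begin
    D (t + + suc k * + L₂)         ≡⟨ cong D (solve t (+ k) (+ L₂)) ⟩
    D (t + + k * + L₂ + + L₂)      ≤⟨ D-period-≤ (t + + k * + L₂) ⟩
    D (t + + k * + L₂)             ≤⟨ D-periods-≤ t k ⟩
    D t                            ∎
    where
    open ℤP.≤-Reasoning
    solve : ∀ t k L → t + (+ 1 + k) * L ≡ t + k * L + L
    solve = solve-∀

  stable⇒D[t+L₂]<0 : ∀ {t} → Stable t → D (t + + L₂) ℤ.< 0ℤ
  stable⇒D[t+L₂]<0 {t} (stable Dt≡0 αt≡N _) = subst (ℤ._< 0ℤ)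
    (sym (trans (D-period t) (cong₂ (λ d x → d + (+ #E [ x ] - + 1)) Dt≡0 αt≡N))) -<+

  stable-not-later : ∀ {t t'} → Stable t → Stable t' → ∀ k → t' ≢ t + + suc k * + L₂
  stable-not-later {t} st (stable Dt'≡0 _ _) k refl = ℤP.<-irrefl Dt'≡0 (begin-strict
    D (t + + suc k * + L₂)          ≡⟨ cong D (solve t (+ k) (+ L₂)) ⟩
    D (t + + L₂ + + k * + L₂)       ≤⟨ D-periods-≤ (t + + L₂) k ⟩
    D (t + + L₂)                    <⟨ stable⇒D[t+L₂]<0 st ⟩
    0ℤ                              ∎)
    where
    open ℤP.≤-Reasoning
    solve : ∀ t k L → t + (+ 1 + k) * L ≡ t + L + k * L
    solve = solve-∀

  -- D is non-increasing along residue classes modulo L₂ and negative one period after a stable point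
  stable-unique-mod : ∀ {t t'} → Stable t → Stable t' → t ℤ.%ℕ L₂ ≡ t' ℤ.%ℕ L₂ → t ≡ t'
  stable-unique-mod {t} {t'} st st' r≡r' with ℤP.<-cmp (t ℤ./ℕ L₂) (t' ℤ./ℕ L₂)
  ... | tri≈ _ q≡q' _ = begin
    t                                    ≡⟨ a≡a%ℕn+[a/ℕn]*n t L₂ ⟩
    + (t ℤ.%ℕ L₂) + t ℤ./ℕ L₂ * + L₂     ≡⟨ cong₂ (λ r q → + r + q * + L₂) r≡r' q≡q' ⟩
    + (t' ℤ.%ℕ L₂) + t' ℤ./ℕ L₂ * + L₂   ≡⟨ a≡a%ℕn+[a/ℕn]*n t' L₂ ⟨
    t'                                   ∎
    where open ≡-Reasoning
  ... | tri< q<q' _ _ = let k , eq = later-in-class t t' r≡r' q<q' in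
    ⊥-elim (stable-not-later st st' k eq)
  ... | tri> _ _ q'<q = let k , eq = later-in-class t' t (sym r≡r') q'<q in
    ⊥-elim (stable-not-later st' st k eq)

  -- after L₁ L₂ steps the upper path has gained L₂ m' and the lower one L₁ (m' + 1)
  D-drift : ∀ t c → D (t + c * + L₁ * + L₂) ≡ D t - c * + suc n'
  D-drift t c = begin
    Upper.X (t + c * + L₁ * + L₂) - Lower.X (t + c * + L₁ * + L₂)
      ≡⟨ cong₂ _-_ upper lower ⟩
    Upper.X t + c * + L₂ * + m' - (Lower.X t + c * + L₁ * (+ 1 + + m'))
      ≡⟨ cong₂ (λ L L′ → Upper.X t + c * L′ * + m' - (Lower.X t + c * L * (+ 1 + + m'))) +L₁≡ +L₂≡ ⟩
    Upper.X t + c * (+ 1 + (+ 1 + (+ m' + + n'))) * + m' - (Lower.X t + c * (+ 1 + (+ m' + + n')) * (+ 1 + + m'))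
      ≡⟨ solve (Upper.X t) (Lower.X t) c (+ m') (+ n') ⟩
    D t - c * (+ 1 + + n') ∎
    where
    open ≡-Reasoning
    solve : ∀ a b c m n → a + c * (+ 1 + (+ 1 + (m + n))) * m - (b + c * (+ 1 + (m + n)) * (+ 1 + m)) ≡
                          a - b - c * (+ 1 + n)
    solve = solve-∀
    +L₁≡ : + L₁ ≡ + 1 + (+ m' + + n')
    +L₁≡ = trans (cong (λ n → + suc n) length-u) (cong (λ e → + 1 + e) (ℤP.pos-+ m' n'))
    +L₂≡ : + L₂ ≡ + 1 + (+ 1 + (+ m' + + n'))
    +L₂≡ = trans (cong +_ L₂≡1+L₁) (cong (λ e → + 1 + e) +L₁≡)
    upper : Upper.X (t + c * + L₁ * + L₂) ≡ Upper.X t + c * + L₂ * + m'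
    upper = begin
      Upper.X (t + c * + L₁ * + L₂)       ≡⟨ cong (λ e → Upper.X (t + e)) (solve′ c (+ L₁) (+ L₂)) ⟩
      Upper.X (t + c * + L₂ * + L₁)       ≡⟨ Upper.X-periodic t (c * + L₂) ⟩
      Upper.X t + c * + L₂ * + #E u       ≡⟨ cong (λ e → Upper.X t + c * + L₂ * + e) #E-u ⟩
      Upper.X t + c * + L₂ * + m'         ∎
      where
      solve′ : ∀ c a b → c * a * b ≡ c * b * a
      solve′ = solve-∀
    lower : Lower.X (t + c * + L₁ * + L₂) ≡ Lower.X t + c * + L₁ * (+ 1 + + m')
    lower = trans (Lower.X-periodic t (c * + L₁)) (cong (λ e → Lower.X t + c * + L₁ * + suc e) #E-l)

  private
    i<j⇒i-j<0 : ∀ {i j} → i ℤ.< j → i - j ℤ.< 0ℤ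
    i<j⇒i-j<0 {i} {j} i<j = subst (i - j ℤ.<_) (ℤP.+-inverseʳ j) (ℤP.+-monoˡ-< (- j) i<j)

    +r<[1+c]*[1+n] : ∀ {r c} → r ℕ.≤ c → + r ℤ.< + suc c * + suc n'
    +r<[1+c]*[1+n] {r} {c} r≤c = subst (+ r ℤ.<_) (ℤP.pos-* (suc c) (suc n'))
      (+<+ (ℕP.<-≤-trans (s≤s r≤c) (ℕP.m≤m*n (suc c) (suc n'))))

  D-far-negative : ∀ r c → r ℕ.≤ c → D (+ r + + suc c * + L₁ * + L₂) ℤ.< 0ℤ
  D-far-negative r c r≤c = subst (ℤ._< 0ℤ) (sym (D-drift (+ r) (+ suc c)))
    (i<j⇒i-j<0 (ℤP.≤-<-trans (proj₂ (D-bounds refl r)) (+r<[1+c]*[1+n] r≤c)))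

  D-far-nonnegative : ∀ r c → r ℕ.≤ c → 0ℤ ℤ.≤ D (+ r + - + suc c * + L₁ * + L₂)
  D-far-nonnegative r c r≤c = subst (0ℤ ℤ.≤_)
    (sym (trans (D-drift (+ r) (- + suc c)) (cong (λ e → D (+ r) - e) (ℤP.neg-distribˡ-* (+ suc c) (+ suc n')))))
    (ℤP.i≤j⇒0≤j-i (ℤP.≤-trans (ℤP.neg-mono-≤ (ℤP.<⇒≤ (+r<[1+c]*[1+n] r≤c))) (proj₁ (D-bounds refl r))))

  opaque
    residue-crossing : ∀ r → ∃[ c ] 0ℤ ℤ.≤ D (+ r + c * + L₂) × D (+ r + (c + + 1) * + L₂) ℤ.< 0ℤ
    residue-crossing r = sign-change (λ c → D (+ r + c * + L₂)) (- + suc r * + L₁) (K ℕ.+ K)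
      (D-far-nonnegative r r ℕP.≤-refl)
      (subst (λ c → D (+ r + c * + L₂) ℤ.< 0ℤ) (sym far) (D-far-negative r r ℕP.≤-refl))
      where
      K : ℕ
      K = suc r ℕ.* L₁
      far : - + suc r * + L₁ + + (K ℕ.+ K) ≡ + suc r * + L₁
      far = trans (cong (λ e → - + suc r * + L₁ + e)
                        (trans (ℤP.pos-+ K K) (cong₂ _+_ (ℤP.pos-* (suc r) L₁) (ℤP.pos-* (suc r) L₁))))
                  (solve (+ suc r) (+ L₁))
        where
        solve : ∀ a b → - a * b + (a * b + a * b) ≡ a * b
        solve = solve-∀

  -- the stable intersection in the residue class of r, when r is the position of an E of E l
  crossing-point : ℕ → ℤ
  crossing-point r = + r + proj₁ (residue-crossing r) * + L₂

  crossing-point-stable : ∀ r → r ℕ.< L₂ → at Lower.W r ≡ E → Stable (crossing-point r)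
  crossing-point-stable r r<L₂ Wr≡E =
    let Dt≡0 , αt≡N , _ = crossing (D t) (Upper.s t) E (proj₁ (proj₂ (residue-crossing r))) D[t+L₂]<0
    in stable Dt≡0 αt≡N (trans (Lower.s-canonical c r r<L₂) Wr≡E)
    where
    c = proj₁ (residue-crossing r)
    t = crossing-point r
    D[t+L₂]<0 : D t + (+ #E [ Upper.s t ] - + 1) ℤ.< 0ℤ
    D[t+L₂]<0 = subst (ℤ._< 0ℤ) (trans (cong D (solve (+ r) c (+ L₂))) (D-period t))
                      (proj₂ (proj₂ (residue-crossing r)))
      where
      solve : ∀ r c L → r + (c + + 1) * L ≡ r + c * L + L
      solve = solve-∀

  crossing-point-%ℕ : ∀ r → r ℕ.< L₂ → crossing-point r ℤ.%ℕ L₂ ≡ r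
  crossing-point-%ℕ r = [r+q*L]%ℕL≡r r (proj₁ (residue-crossing r))

  NegativeAfter : ℤ → Set
  NegativeAfter t = ∀ i → 1 ℕ.≤ i → i ℕ.≤ L₂ → D (t + + i) ℤ.< 0ℤ

  negativeAfter-forever : ∀ {t} → NegativeAfter t → ∀ i → 1 ℕ.≤ i → D (t + + i) ℤ.< 0ℤ
  negativeAfter-forever {t} neg i 1≤i = go i i 1≤i ℕP.≤-refl
    where
    go : ∀ n i → 1 ℕ.≤ i → i ℕ.≤ n → D (t + + i) ℤ.< 0ℤ
    go n i 1≤i i≤n with i ℕ.≤? L₂
    go n       i 1≤i i≤n   | yes i≤L₂ = neg i 1≤i i≤L₂
    go zero    i 1≤i i≤0   | no  _    = ⊥-elim (ℕP.<⇒≱ 1≤i i≤0)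
    go (suc n) i 1≤i i≤1+n | no  i≰L₂ = ℤP.≤-<-trans (begin
      D (t + + i)                 ≡⟨ cong D i≡j+L₂ ⟩
      D (t + + j + + L₂)          ≤⟨ D-period-≤ (t + + j) ⟩
      D (t + + j)                 ∎)
      (go n j (ℕP.m<n⇒0<n∸m L₂<i) (ℕP.≤-trans (ℕP.∸-monoʳ-≤ i (s≤s z≤n)) (ℕP.∸-monoˡ-≤ 1 i≤1+n)))
      where
      open ℤP.≤-Reasoning
      L₂<i = ℕP.≰⇒> i≰L₂
      j = i ℕ.∸ L₂
      i≡j+L₂ : t + + i ≡ t + + j + + L₂
      i≡j+L₂ = trans (cong (λ k → t + k) (trans (cong +_ (sym (ℕP.m∸n+n≡m (ℕP.<⇒≤ L₂<i)))) (ℤP.pos-+ j L₂)))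
                     (sym (ℤP.+-assoc t (+ j) (+ L₂)))

  negativeAfter-unique : ∀ {t t'} → Stable t → NegativeAfter t → Stable t' → NegativeAfter t' → t ≡ t'
  negativeAfter-unique {t} {t'} st neg st' neg' with ℤP.<-cmp t t'
  ... | tri≈ _ t≡t' _ = t≡t'
  ... | tri< t<t' _ _ = let k , t'≡ = <⇒≡+suc t<t' in
    ⊥-elim (ℤP.<-irrefl (Stable.D≡0 st')
      (subst (λ x → D x ℤ.< 0ℤ) (sym t'≡) (negativeAfter-forever {t} neg (suc k) (s≤s z≤n))))
  ... | tri> _ _ t'<t = let k , t≡ = <⇒≡+suc t'<t in
    ⊥-elim (ℤP.<-irrefl (Stable.D≡0 st)
      (subst (λ x → D x ℤ.< 0ℤ) (sym t≡) (negativeAfter-forever {t'} neg' (suc k) (s≤s z≤n))))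

  private
    horizon : ℕ
    horizon = suc L₂ ℕ.* L₁ ℕ.* L₂

    D-beyond-horizon : ∀ r → r ℕ.≤ L₂ → D (+ (horizon ℕ.+ r)) ℤ.< 0ℤ
    D-beyond-horizon r r≤L₂ = subst (λ x → D x ℤ.< 0ℤ) (sym index≡) (D-far-negative r L₂ r≤L₂)
      where
      index≡ : + (horizon ℕ.+ r) ≡ + r + + suc L₂ * + L₁ * + L₂
      index≡ = trans (cong +_ (ℕP.+-comm horizon r)) (trans (ℤP.pos-+ r horizon)
        (cong (λ e → + r + e) (trans (ℤP.pos-* (suc L₂ ℕ.* L₁) L₂) (cong (_* + L₂) (ℤP.pos-* (suc L₂) L₁)))))

  -- the last index ≥ 0 at which D is non-negative
  negativeAfter-exists : ∃[ t ] Stable t × NegativeAfter t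
  negativeAfter-exists
    with last-nonnegative (λ j → D (+ j)) horizon ℤP.≤-refl
           (subst (λ j → D (+ j) ℤ.< 0ℤ) (ℕP.+-identityʳ horizon) (D-beyond-horizon 0 z≤n))
  ... | s , s<horizon , 0≤Ds , after =
    + s ,
    crossing⇒stable (+ s) 0≤Ds (subst (λ x → D x ℤ.< 0ℤ) (k+[1+i]≡k+i+1 0ℤ s) (after (suc s) ℕP.≤-refl s<horizon)) ,
    λ i 1≤i i≤L₂ → subst (λ x → D x ℤ.< 0ℤ) (ℤP.pos-+ s i) (negative i 1≤i i≤L₂ (s ℕ.+ i ℕ.≤? horizon))
    where
    negative : ∀ i → 1 ℕ.≤ i → i ℕ.≤ L₂ → Dec (s ℕ.+ i ℕ.≤ horizon) → D (+ (s ℕ.+ i)) ℤ.< 0ℤ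
    negative i 1≤i _    (yes s+i≤horizon) = after (s ℕ.+ i) (ℕP.m<m+n s 1≤i) s+i≤horizon
    negative i _   i≤L₂ (no  s+i≰horizon) = subst (λ j → D (+ j) ℤ.< 0ℤ) (ℕP.m+[n∸m]≡n (ℕP.<⇒≤ (ℕP.≰⇒> s+i≰horizon)))
      (D-beyond-horizon (s ℕ.+ i ℕ.∸ horizon) (ℕP.≤-trans (ℕP.∸-monoʳ-≤ (s ℕ.+ i) (ℕP.<⇒≤ s<horizon))
                                              (ℕP.≤-trans (ℕP.≤-reflexive (ℕP.m+n∸m≡n s i)) i≤L₂)))

  length-upper-path : ∀ t → length (N ∷ (proj₁ (F t) ++ [ E ])) ≡ L₂
  length-upper-path t = trans
    (cong suc (trans (ListP.length-++ (proj₁ (F t)))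
                     (trans (ℕP.+-comm _ 1) (cong suc (trans (length-win Upper.s (t + + 1) _) (sym length-u))))))
    (sym L₂≡1+L₁)

  length-lower-path : ∀ t → length (E ∷ proj₂ (F t)) ≡ L₂
  length-lower-path t = cong suc (trans (length-win Lower.s (t + + 1) _) (sym length-l))

  take-upper-path : ∀ {t} → Stable t → ∀ i → i ℕ.≤ L₁ → take i (N ∷ (proj₁ (F t) ++ [ E ])) ≡ win Upper.s t i
  take-upper-path {t} st i i≤L₁ = begin
    take i ((N ∷ a) ++ [ E ])
      ≡⟨ take-++ˡ i (N ∷ a) [ E ] (subst (i ℕ.≤_) (trans (sym (length-win Upper.s t L₁)) (cong length period-word)) i≤L₁) ⟩
    take i (N ∷ a)              ≡⟨ cong (take i) period-word ⟨
    take i (win Upper.s t L₁)   ≡⟨ take-win Upper.s t L₁ i i≤L₁ ⟩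
    win Upper.s t i             ∎
    where
    open ≡-Reasoning
    a = proj₁ (F t)
    period-word : win Upper.s t L₁ ≡ N ∷ a
    period-word = cong₂ _∷_ (Stable.α≡N st) (cong (win Upper.s (t + + 1)) length-u)

  take-lower-path : ∀ {t} → Stable t → ∀ i → i ℕ.≤ L₂ → take i (E ∷ proj₂ (F t)) ≡ win Lower.s t i
  take-lower-path {t} st i i≤L₂ = trans (cong (take i) (sym period-word)) (take-win Lower.s t L₂ i i≤L₂)
    where
    period-word : win Lower.s t L₂ ≡ E ∷ proj₂ (F t)
    period-word = cong₂ _∷_ (Stable.β≡E st) (cong (win Lower.s (t + + 1)) length-l)

  D-after-stable : ∀ {t} → Stable t → ∀ i → D (t + + i) ≡ + #E (win Upper.s t i) - + #E (win Lower.s t i)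
  D-after-stable {t} st i = trans (D-win t i) (trans (cong (_+ Δ) (Stable.D≡0 st)) (ℤP.+-identityˡ Δ))
    where Δ = + #E (win Upper.s t i) - + #E (win Lower.s t i)

  meet⇒D≡0 : ∀ {t} → Stable t → ∀ i → pos (win Upper.s t i) ≡ pos (win Lower.s t i) → D (t + + i) ≡ 0ℤ
  meet⇒D≡0 st i meet = trans (D-after-stable st i) (ℤP.i≡j⇒i-j≡0 (cong (λ p → + proj₁ p) meet))

  D≡0⇒meet : ∀ {t} → Stable t → ∀ i → D (t + + i) ≡ 0ℤ → pos (win Upper.s t i) ≡ pos (win Lower.s t i)
  D≡0⇒meet {t} st i D≡0 = cong₂ _,_ #E≡ (#N-determined (win Upper.s t i) (win Lower.s t i)
    (trans (length-win Upper.s t i) (sym (length-win Lower.s t i))) #E≡)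
    where
    #E≡ : #E (win Upper.s t i) ≡ #E (win Lower.s t i)
    #E≡ = ℤP.+-injective (ℤP.i-j≡0⇒i≡j _ _ (trans (sym (D-after-stable st i)) D≡0))

  private
    <L₂⇒≤L₁ : ∀ {i} → i ℕ.< L₂ → i ℕ.≤ L₁
    <L₂⇒≤L₁ {i} i<L₂ = ℕP.≤-pred (subst (suc i ℕ.≤_) L₂≡1+L₁ i<L₂)

    L₁≤L₂ : L₁ ℕ.≤ L₂
    L₁≤L₂ = subst (L₁ ℕ.≤_) (sym L₂≡1+L₁) (ℕP.n≤1+n L₁)

  negativeAfter⇒parallelogram : ∀ {t} → Stable t → NegativeAfter t → Parallelogram (suc m') (suc n') (F t)
  negativeAfter⇒parallelogram {t} st neg p (i , i≤ , eᵤ) (i' , i'≤ , eₗ) with same-index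
    where
    same-index : i ≡ i'
    same-index = trans (sym (pos-take-sum i _ i≤))
      (trans (cong (λ q → proj₁ q ℕ.+ proj₂ q) (trans eᵤ (sym eₗ))) (pos-take-sum i' _ i'≤))
  ... | refl with ℕP.m≤n⇒m<n∨m≡n (subst (i ℕ.≤_) (length-lower-path t) i'≤)
  ...   | inj₂ refl = inj₂ (begin
    p                                ≡⟨ eₗ ⟨
    pos (take L₂ (E ∷ proj₂ (F t)))
      ≡⟨ cong pos (ListP.take-all L₂ (E ∷ proj₂ (F t)) (ℕP.≤-reflexive (length-lower-path t))) ⟩
    pos (E ∷ proj₂ (F t))            ≡⟨ cong₂ _,_ (cong suc (proj₁ (proj₂ (F-dom st)))) (proj₂ (proj₂ (F-dom st))) ⟩
    (suc m' , suc n')                ∎)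
    where open ≡-Reasoning
  ...   | inj₁ i<L₂ with i
  ...     | zero  = inj₁ (sym eₗ)
  ...     | suc j = ⊥-elim (ℤP.<-irrefl (meet⇒D≡0 st (suc j) meet) (neg (suc j) (s≤s z≤n) (ℕP.<⇒≤ i<L₂)))
    where
    meet : pos (win Upper.s t (suc j)) ≡ pos (win Lower.s t (suc j))
    meet = trans (cong pos (sym (take-upper-path st (suc j) (<L₂⇒≤L₁ i<L₂))))
             (trans (trans eᵤ (sym eₗ)) (cong pos (take-lower-path st (suc j) (ℕP.<⇒≤ i<L₂))))

  parallelogram⇒negativeAfter : ∀ {t} → Stable t → Parallelogram (suc m') (suc n') (F t) → NegativeAfter t
  parallelogram⇒negativeAfter {t} st par i 1≤i i≤L₂ with ℕP.m≤n⇒m<n∨m≡n i≤L₂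
  ... | inj₂ refl = stable⇒D[t+L₂]<0 st
  ... | inj₁ i<L₂ = negative-until-zero t L₁ D[t+1]<0 never-zero i 1≤i (<L₂⇒≤L₁ i<L₂)
    where
    D[t+1]<0 : D (t + + 1) ℤ.< 0ℤ
    D[t+1]<0 = subst (ℤ._< 0ℤ) (sym (trans (D-step t)
      (cong₂ (λ d (xy : Step × Step) → d + (+ #E [ proj₁ xy ] - + #E [ proj₂ xy ]))
             (Stable.D≡0 st) (cong₂ _,_ (Stable.α≡N st) (Stable.β≡E st))))) -<+
    never-zero : ∀ j → 1 ℕ.≤ j → j ℕ.≤ L₁ → D (t + + j) ≢ 0ℤ
    never-zero j 1≤j j≤L₁ D≡0 = [ (λ p≡0 → ℕP.<⇒≢ 1≤j (coordinate-sum p≡0)) ,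
                                  (λ p≡end → ℕP.<⇒≱ L₁<m+n (subst (ℕ._≤ L₁) (sym (coordinate-sum p≡end)) j≤L₁)) ]′
                                (par p on-upper on-lower)
      where
      j≤L₂ = ℕP.≤-trans j≤L₁ L₁≤L₂
      p = pos (take j (E ∷ proj₂ (F t)))
      on-lower : OnPath (E ∷ proj₂ (F t)) p
      on-lower = j , subst (j ℕ.≤_) (sym (length-lower-path t)) j≤L₂ , refl
      on-upper : OnPath (N ∷ (proj₁ (F t) ++ [ E ])) p
      on-upper = j , subst (j ℕ.≤_) (sym (length-upper-path t)) j≤L₂ ,
        trans (cong pos (take-upper-path st j j≤L₁))
              (trans (D≡0⇒meet st j D≡0) (cong pos (sym (take-lower-path st j j≤L₂))))
      coordinate-sum : ∀ {q} → p ≡ q → proj₁ q ℕ.+ proj₂ q ≡ j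
      coordinate-sum {q} p≡q = trans (cong (λ q → proj₁ q ℕ.+ proj₂ q) (sym p≡q))
        (pos-take-sum j (E ∷ proj₂ (F t)) (subst (j ℕ.≤_) (sym (length-lower-path t)) j≤L₂))
      L₁<m+n : L₁ ℕ.< suc m' ℕ.+ suc n'
      L₁<m+n = ℕP.≤-reflexive (trans (sym L₂≡1+L₁) (cong suc length-l))

-- the pair (a , b) = F t read off at a stable intersection t is the pair (u , l) shifted by t
module Shift {m' n' u l} (dom : Dom (suc m') (suc n') (u , l)) {t} (st : Setting.Stable m' n' u l dom t)
             {a b} (dom′ : Dom (suc m') (suc n') (a , b)) (ab≡Ft : (a , b) ≡ Setting.F m' n' u l dom t) where

  open Setting m' n' u l dom
  module S′ = Setting m' n' a b dom′

  upper-shift : ∀ j → S′.Upper.s j ≡ Upper.s (t + j)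
  upper-shift = subst (λ d → ∀ j → stepAt d a j ≡ Upper.s (t + j)) (Stable.α≡N st)
    (cyclic-shift N u t (trans (cong proj₁ ab≡Ft) (cong (win Upper.s (t + + 1)) (sym length-u))))

  lower-shift : ∀ j → S′.Lower.s j ≡ Lower.s (t + j)
  lower-shift = subst (λ d → ∀ j → stepAt d b j ≡ Lower.s (t + j)) (Stable.β≡E st)
    (cyclic-shift E l t (trans (cong proj₂ ab≡Ft) (cong (win Lower.s (t + + 1)) (sym length-l))))

  private
    starts-at-0 : ∀ (x : ℤ → ℤ) → 0ℤ ≡ x (t + 0ℤ) - x t
    starts-at-0 x = sym (trans (cong (λ k → x k - x t) (ℤP.+-identityʳ t)) (ℤP.+-inverseʳ (x t)))

  D-shift : ∀ j → S′.D j ≡ D (t + j)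
  D-shift j = begin
    S′.Upper.X j - S′.Lower.X j
      ≡⟨ cong₂ _-_ (traces-unique upper-shift S′.Upper.traces (traces-shift Upper.traces t) (starts-at-0 Upper.X) j)
                   (traces-unique lower-shift S′.Lower.traces (traces-shift Lower.traces t) (starts-at-0 Lower.X) j) ⟩
    (Upper.X (t + j) - Upper.X t) - (Lower.X (t + j) - Lower.X t)
      ≡⟨ solve (Upper.X (t + j)) (Upper.X t) (Lower.X (t + j)) (Lower.X t) ⟩
    D (t + j) - D t
      ≡⟨ cong (λ d → D (t + j) - d) (Stable.D≡0 st) ⟩
    D (t + j) - 0ℤ
      ≡⟨ ℤP.+-identityʳ (D (t + j)) ⟩
    D (t + j) ∎
    where
    open ≡-Reasoning
    solve : ∀ a b c d → (a - b) - (c - d) ≡ (a - c) - (b - d)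
    solve = solve-∀

  stable-shift⁺ : ∀ {j} → S′.Stable j → Stable (t + j)
  stable-shift⁺ {j} (S′.stable D≡0 α≡N β≡E) =
    stable (trans (sym (D-shift j)) D≡0) (trans (sym (upper-shift j)) α≡N) (trans (sym (lower-shift j)) β≡E)

  stable-shift⁻ : ∀ {j} → Stable (t + j) → S′.Stable j
  stable-shift⁻ {j} (stable D≡0 α≡N β≡E) =
    S′.stable (trans (D-shift j) D≡0) (trans (upper-shift j) α≡N) (trans (lower-shift j) β≡E)

  F-shift : ∀ j → S′.F j ≡ F (t + j)
  F-shift j = cong₂ _,_
    (win-cong S′.Upper.s Upper.s (j + + 1) (t + j + + 1) _
      (λ i _ → trans (upper-shift _) (cong Upper.s (solve t j (+ i)))))
    (win-cong S′.Lower.s Lower.s (j + + 1) (t + j + + 1) _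
      (λ i _ → trans (lower-shift _) (cong Lower.s (solve t j (+ i)))))
    where
    solve : ∀ t j i → t + (j + + 1 + i) ≡ t + j + + 1 + i
    solve = solve-∀

  negativeAfter-shift : ∀ {j} → S′.NegativeAfter j → NegativeAfter (t + j)
  negativeAfter-shift {j} neg i 1≤i i≤L₂ = subst (ℤ._< 0ℤ)
    (trans (D-shift (j + + i)) (cong D (sym (ℤP.+-assoc t j (+ i)))))
    (neg i 1≤i (subst (i ℕ.≤_) (cong suc (trans length-l (sym S′.length-l))) i≤L₂))

  InPi-shift : ∀ z → InPi (suc m') (suc n') (a , b) z ⇔ InPi (suc m') (suc n') (u , l) z
  InPi-shift z = mk⇔
    (λ z∈ → let j , stj , z≡ = S′.InPi⇒stable z∈ in
      subst (InPi (suc m') (suc n') (u , l)) (sym (trans z≡ (F-shift j))) (stable⇒InPi (stable-shift⁺ stj)))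
    (λ z∈ → let t′ , st′ , z≡ = InPi⇒stable z∈
                t+[t′-t]≡t′ = solve t t′ in
      subst (InPi (suc m') (suc n') (a , b))
            (sym (trans z≡ (trans (cong F (sym t+[t′-t]≡t′)) (sym (F-shift (t′ - t))))))
            (S′.stable⇒InPi (stable-shift⁻ (subst Stable (sym t+[t′-t]≡t′) st′))))
    where
    solve : ∀ t t′ → t + (t′ - t) ≡ t′
    solve = solve-∀

module Class (m' n' : ℕ) (u l : Word) (dom : Dom (suc m') (suc n') (u , l)) where

  open Setting m' n' u l dom

  π : Word × Word → Set
  π = InPi (suc m') (suc n') (u , l)

  -- t and t' both carry the parallelogram intersection of the pair F t to one of (u , l)
  F-injective : ∀ {t t'} → Stable t → Stable t' → F t ≡ F t' → t ≡ t'
  F-injective {t} {t'} st st' Ft≡Ft' =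
    +-cancelʳ-≡ j t t' (negativeAfter-unique (T.stable-shift⁺ stj) (T.negativeAfter-shift negj)
                                             (T′.stable-shift⁺ stj) (T′.negativeAfter-shift negj))
    where
    module T  = Shift dom st  (F-dom st) refl
    module T′ = Shift dom st' (F-dom st) Ft≡Ft'
    j = proj₁ T.S′.negativeAfter-exists
    stj = proj₁ (proj₂ T.S′.negativeAfter-exists)
    negj = proj₂ (proj₂ T.S′.negativeAfter-exists)

  members : List (Word × Word)
  members = map (λ r → F (crossing-point r)) (ePositions Lower.W)

  length-members : length members ≡ suc m'
  length-members = trans (ListP.length-map _ (ePositions Lower.W))
                         (trans (length-ePositions Lower.W) (cong suc (proj₁ (proj₂ dom))))

  members-unique : Unique members
  members-unique = map-unique _ injective (ePositions-unique Lower.W)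
    where
    injective : ∀ {r r'} → r ∈ ePositions Lower.W → r' ∈ ePositions Lower.W →
                F (crossing-point r) ≡ F (crossing-point r') → r ≡ r'
    injective {r} {r'} r∈ r'∈ eq =
      let r<L₂ , Wr≡E = ∈-ePositions⁻ Lower.W r∈
          r'<L₂ , Wr'≡E = ∈-ePositions⁻ Lower.W r'∈
      in trans (sym (crossing-point-%ℕ r r<L₂)) (trans
           (cong (ℤ._%ℕ L₂) (F-injective (crossing-point-stable r r<L₂ Wr≡E)
                                         (crossing-point-stable r' r'<L₂ Wr'≡E) eq))
           (crossing-point-%ℕ r' r'<L₂))

  π⇔∈members : ∀ z → π z ⇔ z ∈ members
  π⇔∈members z = mk⇔
    (λ z∈π → let t , st , z≡ = InPi⇒stable z∈π
                 r = t ℤ.%ℕ L₂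
                 r<L₂ = n%ℕd<d t L₂
                 Wr≡E = trans (sym (Lower.s≡at t)) (Stable.β≡E st)
                 point≡t = stable-unique-mod (crossing-point-stable r r<L₂ Wr≡E) st (crossing-point-%ℕ r r<L₂)
             in subst (_∈ members) (sym (trans z≡ (cong F (sym point≡t))))
                      (∈-map⁺ (λ r → F (crossing-point r)) (∈-ePositions⁺ Lower.W r<L₂ Wr≡E)))
    (λ z∈ → let r , r∈ , z≡ = ∈-map⁻ (λ r → F (crossing-point r)) z∈
                r<L₂ , Wr≡E = ∈-ePositions⁻ Lower.W r∈
            in subst π (sym z≡) (stable⇒InPi (crossing-point-stable r r<L₂ Wr≡E)))

  π-dom : ∀ z → π z → Dom (suc m') (suc n') z
  π-dom z z∈π = let t , st , z≡ = InPi⇒stable z∈π in subst (Dom (suc m') (suc n')) (sym z≡) (F-dom st)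

  π-self : π (u , l)
  π-self = subst π F-0 (stable⇒InPi stable-0)

  π-of-member : ∀ {z} → π z → ∀ z' → InPi (suc m') (suc n') z z' ⇔ π z'
  π-of-member {a , b} z∈π = let t , st , z≡ = InPi⇒stable z∈π in
    Shift.InPi-shift dom st (subst (Dom (suc m') (suc n')) (sym z≡) (F-dom st)) z≡

  unique-parallelogram : ∃[ z ] π z × Parallelogram (suc m') (suc n') z ×
                                 (∀ z' → π z' → Parallelogram (suc m') (suc n') z' → z' ≡ z)
  unique-parallelogram =
    let t , st , neg = negativeAfter-exists in
    F t , stable⇒InPi st , negativeAfter⇒parallelogram st neg ,
    λ z' z'∈π par → let t' , st' , z'≡ = InPi⇒stable z'∈π in
      trans z'≡ (cong F (negativeAfter-unique st'
        (parallelogram⇒negativeAfter st' (subst (Parallelogram (suc m') (suc n')) z'≡ par)) st neg))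

_≟-step_ : DecidableEquality Step
N ≟-step N = yes refl
N ≟-step E = no λ ()
E ≟-step N = no λ ()
E ≟-step E = yes refl

open import Data.List.Membership.DecPropositional
  (ProductP.≡-dec (ListP.≡-dec _≟-step_) (ListP.≡-dec _≟-step_)) using (_∈?_)

module _ (m' n' : ℕ) {u l u' l'} (d : Dom (suc m') (suc n') (u , l)) (d' : Dom (suc m') (suc n') (u' , l')) where
  private
    module C  = Class m' n' u l d
    module C′ = Class m' n' u' l' d'

  -- classes are finite lists, so whether two of them share an element is decidable
  π-equal-or-disjoint :
    (∀ z → InPi (suc m') (suc n') (u , l) z ⇔ InPi (suc m') (suc n') (u' , l') z) ⊎
    (∀ z → InPi (suc m') (suc n') (u , l) z → InPi (suc m') (suc n') (u' , l') z → ⊥)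
  π-equal-or-disjoint with any? (_∈? C′.members) C.members
  ... | yes common = let z , z∈ , z∈′ = find common in
    inj₁ λ z' → C′.π-of-member (Equivalence.from (C′.π⇔∈members z) z∈′) z' ⇔-∘
                ⇔-sym (C.π-of-member (Equivalence.from (C.π⇔∈members z) z∈) z')
  ... | no none = inj₂ λ z z∈π z∈π′ →
    none (lose (Equivalence.to (C.π⇔∈members z) z∈π) (Equivalence.to (C′.π⇔∈members z) z∈π′))

lemma3p1 : (m n : ℕ) → 1 ≤ m → 1 ≤ n →
    (∀ x → Dom m n x → ∀ z → InPi m n x z → Dom m n z) ×
    (∀ z → Dom m n z → ∃[ x ] (Dom m n x × InPi m n x z)) ×
    (∀ x x' → Dom m n x → Dom m n x' →
      (∀ z → InPi m n x z ⇔ InPi m n x' z) ⊎ (∀ z → InPi m n x z → InPi m n x' z → ⊥)) ×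
    (∀ x → Dom m n x → ∃[ ps ] (length ps ≡ m × Unique ps × (∀ z → InPi m n x z ⇔ z ∈ ps))) ×
    (∀ x → Dom m n x → ∃[ z ] (InPi m n x z × Parallelogram m n z ×
      (∀ z' → InPi m n x z' → Parallelogram m n z' → z' ≡ z)))
lemma3p1 (suc m') (suc n') _ _ =
  (λ { (u , l) d → Class.π-dom m' n' u l d }) ,
  (λ { (u , l) d → (u , l) , d , Class.π-self m' n' u l d }) ,
  (λ { (u , l) (u' , l') d d' → π-equal-or-disjoint m' n' d d' }) ,
  (λ { (u , l) d → let open Class m' n' u l d in members , length-members , members-unique , π⇔∈members }) ,
  (λ { (u , l) d → Class.unique-parallelogram m' n' u l d })
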